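{- For any positive integers $m$ and $M$ such that $\rho (m,M) \geq 4$, one has $$\rho (m,M) \leq \sqrt{\min (m,M)+5} - 3.$$
   Context: For positive integers $m,M$ define $\rho(m,M)=\min\{t\in\mathbb{Z}_{\ge 0} : \exists\, t'\in\mathbb{Z},\ 0\le t'\le t,\ \gcd(M-t',\,m-(t-t'))=1\}$. -}

module Defs where

open import Data.Nat as ℕ using (ℕ; _≤_; _<_)
open import Data.Integer as ℤ using (ℤ; +_; _-_)
open import Data.Integer.GCD using (gcd)
open import Data.Product using (Σ; _×_)
open import Relation.Binary.PropositionalEquality using (_≡_)
open import Relation.Nullary using (¬_)

Admissible : ℕ → ℕ → ℕ → Set
Admissible m M t =
  Σ ℕ (λ t' → (t' ≤ t) × (gcd (+ M - + t') (+ m - (+ t - + t')) ≡ + 1))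

IsRho : ℕ → ℕ → ℕ → Set
IsRho m M r = Admissible m M r × (∀ t → t < r → ¬ Admissible m M t)

module Submission where

-- Minimality of r = ρ(m, M) says that every cell (i , j) with i + j < r is blocked: |M − i| and
-- |m − j| share a prime. A prime serving two cells of one row divides the distance of their
-- columns, so the primes serving n consecutive columns of a row whose prime factors are all ≥ n
-- are n distinct prime factors of that row. For r < 31 one row suffices: an odd row (r ≥ 4) has
-- three distinct odd prime factors, so M ≥ 3·5·7, and a row prime to 6 (r ≥ 8) has five
-- distinct prime factors ≥ 5, so M ≥ 5⁵. For r ≥ 31 take K = 2ᵉ with 2K ≤ r + 1 < 4K and
-- suppose (r + 3)² > M + 5, so that M < K⁴; count the K² cells i , j < K by a prime serving
-- them. A prime p ≥ K serves at most one column, and a row |M − i| < K⁴ has at most three prime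
-- factors ≥ K, so these primes serve at most 3K cells. A prime in [L, 2L) serves at most (K/L)²
-- cells and at most L/2 numbers of that block are prime, so the primes below K serve at most
-- 3K²/4 − K cells. Hence K² ≤ 3K²/4 + 2K, i.e. K ≤ 8, a contradiction. The blocked cells are
-- symmetric in m and M, so the bound holds for min(m, M).

open import Defs
open import Data.Nat using (ℕ; _≤_; _+_; _*_; _⊓_)
open import Data.Nat.Base
open import Data.Nat.Properties
open import Data.Nat.Divisibility
open import Data.Nat.GCD using (gcd; gcd[m,n]∣m; gcd[m,n]∣n)
open import Data.Nat.ListAction using (product)
open import Data.Nat.Primality
  using (Prime; _Rough_; prime?; euclidsLemma; prime[2]; ¬prime[0]; ¬prime[1]; prime⇒nonTrivial;
         rough⇒≤; rough∧∣⇒rough; ∤⇒rough-suc; 2-rough; composite; composite⇒¬prime)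
open import Data.Nat.Primality.Factorisation using (factorise; factorisationHasAllPrimeFactors)
open import Data.Nat.Tactic.RingSolver using (solve-∀)
import Data.Integer.Base as ℤ
import Data.Integer.Properties as ℤ
import Data.Integer.Divisibility.Signed as ℤ∣
import Data.Integer.Tactic.RingSolver as ℤ-Solver
open import Data.Integer.GCD renaming (gcd to ℤgcd) using ()
open import Algebra.Properties.CommutativeSemigroup +-commutativeSemigroup using (interchange)
open import Data.Fin.Base using (Fin; toℕ)
open import Data.Fin.Properties using (toℕ<n; toℕ-injective)
open import Data.List.Base using ([]; _∷_; length; map; filter; downFrom; tabulate)
open import Data.List.Properties using (length-map; length-tabulate)
open import Data.List.Relation.Unary.All as All using (All; []; _∷_)
open import Data.List.Relation.Unary.All.Properties as All using (all-filter)
open import Data.List.Relation.Unary.Unique.Propositional using (Unique; []; _∷_)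
import Data.List.Relation.Unary.Unique.Propositional.Properties as Unique
open import Data.Product using (∃-syntax; _×_; _,_; proj₁)
open import Data.Sum using (_⊎_; inj₁; inj₂; [_,_]′)
open import Data.Empty using (⊥-elim)
open import Function using (_∘_; flip)
open import Level using (0ℓ)
open import Relation.Binary.Definitions using (Tri; tri<; tri≈; tri>)
open import Relation.Binary.PropositionalEquality
  using (_≡_; _≢_; refl; sym; trans; cong; cong₂; subst; module ≡-Reasoning)
open import Relation.Nullary using (Dec; yes; no; ¬_)
open import Relation.Nullary.Decidable using (_×-dec_)
open import Relation.Nullary.Negation using (contradiction)
open import Relation.Unary using (Pred; Decidable)

∑ : ℕ → (ℕ → ℕ) → ℕ
∑ zero    f = 0
∑ (suc n) f = ∑ n f + f n

syntax ∑ n (λ x → e) = ∑[ x < n ] e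

module _ {f g : ℕ → ℕ} where

  ∑-cong : ∀ n → (∀ x → f x ≡ g x) → ∑ n f ≡ ∑ n g
  ∑-cong zero    eq = refl
  ∑-cong (suc n) eq = cong₂ _+_ (∑-cong n eq) (eq n)

  ∑-mono-≤ : ∀ n → (∀ {x} → x < n → f x ≤ g x) → ∑ n f ≤ ∑ n g
  ∑-mono-≤ zero    le = z≤n
  ∑-mono-≤ (suc n) le = +-mono-≤ (∑-mono-≤ n (le ∘ m<n⇒m<1+n)) (le ≤-refl)

  ∑-distrib-+ : ∀ n → ∑[ x < n ] (f x + g x) ≡ ∑ n f + ∑ n g
  ∑-distrib-+ zero    = refl
  ∑-distrib-+ (suc n) =
    trans (cong (_+ (f n + g n)) (∑-distrib-+ n)) (interchange (∑ n f) (∑ n g) (f n) (g n))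

∑-const : ∀ n c → ∑[ _ < n ] c ≡ n * c
∑-const zero    c = refl
∑-const (suc n) c = trans (cong (_+ c) (∑-const n c)) (+-comm (n * c) c)

∑-comm : ∀ m n (f : ℕ → ℕ → ℕ) → ∑[ x < m ] ∑[ y < n ] f x y ≡ ∑[ y < n ] ∑[ x < m ] f x y
∑-comm zero    n f = sym (trans (∑-const n 0) (*-zeroʳ n))
∑-comm (suc m) n f = trans (cong (_+ ∑[ y < n ] f m y) (∑-comm m n f)) (sym (∑-distrib-+ n))

*-distribˡ-∑ : ∀ n c (f : ℕ → ℕ) → c * ∑ n f ≡ ∑[ x < n ] (c * f x)
*-distribˡ-∑ zero    c f = *-zeroʳ c
*-distribˡ-∑ (suc n) c f =
  trans (*-distribˡ-+ c (∑ n f) (f n)) (cong (_+ c * f n) (*-distribˡ-∑ n c f))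

*-distribʳ-∑ : ∀ n c (f : ℕ → ℕ) → ∑ n f * c ≡ ∑[ x < n ] (f x * c)
*-distribʳ-∑ n c f =
  trans (*-comm (∑ n f) c) (trans (*-distribˡ-∑ n c f) (∑-cong n (λ x → *-comm c (f x))))

∑-*-∑ : ∀ m n (f g : ℕ → ℕ) → ∑[ x < m ] ∑[ y < n ] (f x * g y) ≡ ∑ m f * ∑ n g
∑-*-∑ m n f g =
  trans (∑-cong m (λ x → sym (*-distribˡ-∑ n (f x) g))) (sym (*-distribʳ-∑ m (∑ n g) f))

∑-+ : ∀ m n (f : ℕ → ℕ) → ∑ (m + n) f ≡ ∑ m f + ∑[ x < n ] f (m + x)
∑-+ m zero    f = trans (cong (λ k → ∑ k f) (+-identityʳ m)) (sym (+-identityʳ (∑ m f)))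
∑-+ m (suc n) f = begin
  ∑ (m + suc n) f                            ≡⟨ cong (λ k → ∑ k f) (+-suc m n) ⟩
  ∑ (m + n) f + f (m + n)                    ≡⟨ cong (_+ f (m + n)) (∑-+ m n f) ⟩
  ∑ m f + ∑[ x < n ] f (m + x) + f (m + n)   ≡⟨ +-assoc (∑ m f) _ _ ⟩
  ∑ m f + (∑[ x < n ] f (m + x) + f (m + n)) ∎
  where open ≡-Reasoning

∑-*2 : ∀ n (f : ℕ → ℕ) → ∑ (n * 2) f ≡ ∑[ x < n ] (f (x * 2) + f (suc (x * 2)))
∑-*2 zero    f = refl
∑-*2 (suc n) f = trans (cong (λ s → s + f (n * 2) + f (suc (n * 2))) (∑-*2 n f))
                       (+-assoc _ (f (n * 2)) (f (suc (n * 2))))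

term≤∑ : ∀ {x} n (f : ℕ → ℕ) → x < n → f x ≤ ∑ n f
term≤∑ (suc n) f x<1+n with m<1+n⇒m<n∨m≡n x<1+n
... | inj₁ x<n  = ≤-trans (term≤∑ n f x<n) (m≤m+n (∑ n f) _)
... | inj₂ refl = m≤n+m _ (∑ n f)

𝟙 : ∀ {P : Set} → Dec P → ℕ
𝟙 (yes _) = 1
𝟙 (no _)  = 0

𝟙≤1 : ∀ {P : Set} (P? : Dec P) → 𝟙 P? ≤ 1
𝟙≤1 (yes _) = ≤-refl
𝟙≤1 (no _)  = z≤n

𝟙-yes : ∀ {P : Set} (P? : Dec P) → P → 𝟙 P? ≡ 1
𝟙-yes (yes _) _ = refl
𝟙-yes (no ¬p) p = ⊥-elim (¬p p)

≤-𝟙* : ∀ {P : Set} (P? : Dec P) {x y} → (P → x ≤ y) → (¬ P → x ≡ 0) → x ≤ 𝟙 P? * y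
≤-𝟙* (yes p) x≤y _   = ≤-trans (x≤y p) (≤-reflexive (sym (+-identityʳ _)))
≤-𝟙* (no ¬p) _   x≡0 = ≤-reflexive (x≡0 ¬p)

𝟙*≤ : ∀ {P : Set} (P? : Dec P) y → 𝟙 P? * y ≤ y
𝟙*≤ P? y = ≤-trans (*-monoˡ-≤ y (𝟙≤1 P?)) (≤-reflexive (*-identityˡ y))

module _ {P : Pred ℕ 0ℓ} (P? : Decidable P) where

  ∑-𝟙≡0 : ∀ n → (∀ {x} → x < n → ¬ P x) → ∑[ x < n ] 𝟙 (P? x) ≡ 0
  ∑-𝟙≡0 zero    _  = refl
  ∑-𝟙≡0 (suc n) ¬P with P? n
  ... | yes p = ⊥-elim (¬P ≤-refl p)
  ... | no _  = trans (+-identityʳ _) (∑-𝟙≡0 n (¬P ∘ m<n⇒m<1+n))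

  ∑-𝟙≡length-filter : ∀ n → ∑[ x < n ] 𝟙 (P? x) ≡ length (filter P? (downFrom n))
  ∑-𝟙≡length-filter zero    = refl
  ∑-𝟙≡length-filter (suc n) with P? n
  ... | yes _ = trans (+-comm _ 1) (cong suc (∑-𝟙≡length-filter n))
  ... | no _  = trans (+-identityʳ _) (∑-𝟙≡length-filter n)

Separated : ℕ → Pred ℕ 0ℓ → Set
Separated L P = ∀ {x y} → x ≢ y → P x → P y → L ≤ ∣ x - y ∣

module _ {L : ℕ} {P : Pred ℕ 0ℓ} where

  separated-shift : ∀ k → Separated L P → Separated L (λ x → P (k + x))
  separated-shift k sep x≢y px py =
    subst (L ≤_) (∣m+n-m+o∣≡∣n-o∣ k _ _) (sep (x≢y ∘ +-cancelˡ-≡ k _ _) px py)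

  ∑-𝟙-separated≤1 : (P? : Decidable P) → Separated L P → ∀ n → n ≤ L → ∑[ x < n ] 𝟙 (P? x) ≤ 1
  ∑-𝟙-separated≤1 P? sep zero    _   = z≤n
  ∑-𝟙-separated≤1 P? sep (suc n) n<L with P? n
  ... | no _   = ≤-trans (≤-reflexive (+-identityʳ _)) (∑-𝟙-separated≤1 P? sep n (<⇒≤ n<L))
  ... | yes pn = ≤-reflexive (cong (_+ 1) (∑-𝟙≡0 P? n isolated))
    where
    isolated : ∀ {x} → x < n → ¬ P x
    isolated {x} x<n px = <⇒≱ n<L (begin
      L          ≤⟨ sep (<⇒≢ x<n) px pn ⟩
      ∣ x - n ∣  ≡⟨ m≤n⇒∣m-n∣≡n∸m (<⇒≤ x<n) ⟩
      n ∸ x      ≤⟨ m∸n≤m n x ⟩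
      n          ∎)
      where open ≤-Reasoning

∑-𝟙-separated : ∀ {L} {P : Pred ℕ 0ℓ} (P? : Decidable P) → Separated L P →
                ∀ d → ∑[ x < d * L ] 𝟙 (P? x) ≤ d
∑-𝟙-separated         P? sep zero    = z≤n
∑-𝟙-separated {L} P? sep (suc d) = begin
  ∑[ x < L + d * L ] 𝟙 (P? x)                          ≡⟨ ∑-+ L (d * L) _ ⟩
  ∑[ x < L ] 𝟙 (P? x) + ∑[ x < d * L ] 𝟙 (P? (L + x)) ≤⟨ +-mono-≤ (∑-𝟙-separated≤1 P? sep L ≤-refl) rest≤d ⟩
  1 + d                                                 ∎
  where
  open ≤-Reasoning
  rest≤d = ∑-𝟙-separated (P? ∘ (L +_)) (separated-shift L sep) d

∣+m-+n∣≡∣m-n∣ : ∀ m n → ℤ.∣ ℤ.+ m ℤ.- ℤ.+ n ∣ ≡ ∣ m - n ∣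
∣+m-+n∣≡∣m-n∣ m n with ≤-total m n
... | inj₁ m≤n = begin
  ℤ.∣ ℤ.+ m ℤ.- ℤ.+ n ∣  ≡⟨ cong ℤ.∣_∣ (ℤ.[+m]-[+n]≡m⊖n m n) ⟩
  ℤ.∣ m ℤ.⊖ n ∣          ≡⟨ ℤ.∣⊖∣-≤ m≤n ⟩
  n ∸ m                  ≡⟨ m≤n⇒∣m-n∣≡n∸m m≤n ⟨
  ∣ m - n ∣              ∎
  where open ≡-Reasoning
... | inj₂ n≤m = begin
  ℤ.∣ ℤ.+ m ℤ.- ℤ.+ n ∣  ≡⟨ ℤ.∣i-j∣≡∣j-i∣ (ℤ.+ m) (ℤ.+ n) ⟩
  ℤ.∣ ℤ.+ n ℤ.- ℤ.+ m ∣  ≡⟨ cong ℤ.∣_∣ (ℤ.[+m]-[+n]≡m⊖n n m) ⟩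
  ℤ.∣ n ℤ.⊖ m ∣          ≡⟨ ℤ.∣⊖∣-≤ n≤m ⟩
  m ∸ n                  ≡⟨ m≤n⇒∣m-n∣≡n∸m n≤m ⟨
  ∣ n - m ∣              ≡⟨ ∣-∣-comm n m ⟩
  ∣ m - n ∣              ∎
  where open ≡-Reasoning

∣n-i∣≡n∸i : ∀ {n i} → i ≤ n → ∣ n - i ∣ ≡ n ∸ i
∣n-i∣≡n∸i {n} {i} i≤n = trans (∣-∣-comm n i) (m≤n⇒∣m-n∣≡n∸m i≤n)

∣n-i∣≤n : ∀ {n i} → i ≤ n → ∣ n - i ∣ ≤ n
∣n-i∣≤n {n} {i} i≤n = ≤-trans (≤-reflexive (∣n-i∣≡n∸i i≤n)) (m∸n≤m n i)

∣n-i∣-nonZero : ∀ {n i} → i < n → NonZero ∣ n - i ∣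
∣n-i∣-nonZero i<n = ≢-nonZero (<⇒≢ i<n ∘ sym ∘ ∣m-n∣≡0⇒m≡n)

-- In ℤ the two differences telescope: (n - x) - (n - y) = y - x.
∣∣n-x∣∧∣∣n-y∣⇒∣∣x-y∣ : ∀ {p n x y} → p ∣ ∣ n - x ∣ → p ∣ ∣ n - y ∣ → p ∣ ∣ x - y ∣
∣∣n-x∣∧∣∣n-y∣⇒∣∣x-y∣ {p} {n} {x} {y} p∣n-x p∣n-y =
  subst (p ∣_) (trans (∣+m-+n∣≡∣m-n∣ y x) (∣-∣-comm y x)) (ℤ∣.∣⇒∣ᵤ p∣y-x)
  where
  lift : ∀ {z} → p ∣ ∣ n - z ∣ → ℤ.+ p ℤ∣.∣ ℤ.+ n ℤ.- ℤ.+ z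
  lift {z} p∣n-z = ℤ∣.∣ᵤ⇒∣ (subst (p ∣_) (sym (∣+m-+n∣≡∣m-n∣ n z)) p∣n-z)
  telescope : ∀ a b c → (a ℤ.- b) ℤ.- (a ℤ.- c) ≡ c ℤ.- b
  telescope = ℤ-Solver.solve-∀
  p∣y-x : ℤ.+ p ℤ∣.∣ ℤ.+ y ℤ.- ℤ.+ x
  p∣y-x = subst (ℤ.+ p ℤ∣.∣_) (telescope (ℤ.+ n) (ℤ.+ x) (ℤ.+ y))
                (ℤ∣.∣m∣n⇒∣m-n (lift p∣n-x) (lift p∣n-y))

∣∣n-x∣∧∣∣n-y∣⇒≤∣x-y∣ : ∀ {p n x y} → x ≢ y → p ∣ ∣ n - x ∣ → p ∣ ∣ n - y ∣ → p ≤ ∣ x - y ∣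
∣∣n-x∣∧∣∣n-y∣⇒≤∣x-y∣ {n = n} x≢y p∣n-x p∣n-y =
  ∣⇒≤ {{≢-nonZero (x≢y ∘ ∣m-n∣≡0⇒m≡n)}} (∣∣n-x∣∧∣∣n-y∣⇒∣∣x-y∣ {n = n} p∣n-x p∣n-y)

∃-prime-divisor : ∀ g → g ≢ 1 → ∃[ p ] Prime p × p ∣ g
∃-prime-divisor zero       _   = 2 , prime[2] , (2 ∣0)
∃-prime-divisor (suc zero) g≢1 = contradiction refl g≢1
∃-prime-divisor g@(2+ _)   _   with factorise g
... | record { factors = p ∷ _ ; isFactorisation = g≡Πps ; factorsPrime = prime-p ∷ _ } =
  p , prime-p , subst (p ∣_) (sym g≡Πps) (m∣m*n _)

rough∧prime∣⇒≤ : ∀ {n a p} → n Rough a → Prime p → p ∣ a → n ≤ p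
rough∧prime∣⇒≤ rough prime-p p∣a = rough⇒≤ {{prime⇒nonTrivial prime-p}} (rough∧∣⇒rough rough p∣a)

product-∣ : ∀ {a ps} → Unique ps → All (λ p → Prime p × p ∣ a) ps → product ps ∣ a
product-∣ [] [] = 1∣ _
product-∣ {ps = p ∷ ps} uniq@(_ ∷ uniq′) ((prime-p , p∣a) ∷ divisors)
  with product-∣ uniq′ divisors
... | divides c a≡c*Π with euclidsLemma c (product ps) prime-p (subst (p ∣_) a≡c*Π p∣a)
...   | inj₁ p∣c = subst (p * product ps ∣_) (sym a≡c*Π) (*-monoˡ-∣ (product ps) p∣c)
...   | inj₂ p∣Π = contradiction
        (factorisationHasAllPrimeFactors prime-p p∣Π (All.map proj₁ divisors))
        (Unique.Unique[x∷xs]⇒x∉xs uniq)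

^-length≤product : ∀ {b ps} → All (b ≤_) ps → b ^ length ps ≤ product ps
^-length≤product []         = ≤-refl
^-length≤product (b≤p ∷ bs) = *-mono-≤ b≤p (^-length≤product bs)

^-∑-prime-divisors≤ : ∀ {a} .{{_ : NonZero a}} b n →
                      b ^ (∑[ x < n ] 𝟙 (prime? (b + x) ×-dec (b + x) ∣? a)) ≤ a
^-∑-prime-divisors≤ {a} b n = begin
  b ^ (∑[ x < n ] 𝟙 (P? x)) ≡⟨ cong (b ^_) (trans (∑-𝟙≡length-filter P? n) (sym (length-map _ xs))) ⟩
  b ^ length ps             ≤⟨ ^-length≤product (All.map⁺ (All.universal (m≤m+n b) xs)) ⟩
  product ps                ≤⟨ ∣⇒≤ (product-∣ unique (All.map⁺ (all-filter P? (downFrom n)))) ⟩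
  a                         ∎
  where
  open ≤-Reasoning
  P? = λ x → prime? (b + x) ×-dec (b + x) ∣? a
  xs = filter P? (downFrom n)
  ps = map (b +_) xs
  unique : Unique ps
  unique = Unique.map⁺ (+-cancelˡ-≡ b _ _) (Unique.filter⁺ P? (Unique.downFrom⁺ n))

even>2⇒¬prime : ∀ {p} → 2 < p → 2 ∣ p → ¬ Prime p
even>2⇒¬prime 2<p 2∣p = composite⇒¬prime (composite 2<p 2∣p)

-- Only the odd numbers of the window can be prime.
∑-𝟙-prime-window≤ : ∀ {b} → 2 < b → 2 ∣ b → ∀ n → ∑[ w < n * 2 ] 𝟙 (prime? (b + w)) ≤ n
∑-𝟙-prime-window≤ {b} 2<b 2∣b n = begin
  ∑[ w < n * 2 ] 𝟙 (prime? (b + w))                                   ≡⟨ ∑-*2 n _ ⟩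
  ∑[ x < n ] (𝟙 (prime? (b + x * 2)) + 𝟙 (prime? (b + suc (x * 2)))) ≤⟨ ∑-mono-≤ n pair≤1 ⟩
  ∑[ x < n ] 1                                                         ≡⟨ ∑-const n 1 ⟩
  n * 1                                                                ≡⟨ *-identityʳ n ⟩
  n                                                                    ∎
  where
  open ≤-Reasoning
  no-even-prime : ∀ x → 𝟙 (prime? (b + x * 2)) ≤ 0
  no-even-prime x with prime? (b + x * 2)
  ... | no  _       = z≤n
  ... | yes prime-p = contradiction prime-p
                        (even>2⇒¬prime (<-≤-trans 2<b (m≤m+n b _)) (∣m∣n⇒∣m+n 2∣b (n∣m*n x)))
  pair≤1 : ∀ {x} → x < n → 𝟙 (prime? (b + x * 2)) + 𝟙 (prime? (b + suc (x * 2))) ≤ 1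
  pair≤1 {x} _ = +-mono-≤ (no-even-prime x) (𝟙≤1 _)

-- Blocked cells

-- Cell (i , j) stands for the pair (M - i , m - j); it is blocked when the two share a prime.
record Blocked (M m r : ℕ) : Set where
  field
    shared-prime : ∀ i j → i + j < r → ∃[ p ] Prime p × p ∣ ∣ M - i ∣ × p ∣ ∣ m - j ∣

open Blocked

isRho⇒blocked : ∀ {m M r} → IsRho m M r → Blocked M m r
isRho⇒blocked {m} {M} (_ , minimal) .shared-prime i j i+j<r with gcd ∣ M - i ∣ ∣ m - j ∣ ≟ 1
... | yes coprime = contradiction (i , m≤m+n i j , gcd≡1) (minimal (i + j) i+j<r)
  where
  i+j-i≡j : ℤ.+ (i + j) ℤ.- ℤ.+ i ≡ ℤ.+ j
  i+j-i≡j = trans (ℤ.[+m]-[+n]≡m⊖n (i + j) i) (trans (ℤ.≤-⊖ (m≤m+n i j)) (cong ℤ.+_ (m+n∸m≡n i j)))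
  gcd≡1 : ℤgcd (ℤ.+ M ℤ.- ℤ.+ i) (ℤ.+ m ℤ.- (ℤ.+ (i + j) ℤ.- ℤ.+ i)) ≡ ℤ.+ 1
  gcd≡1 rewrite i+j-i≡j | ∣+m-+n∣≡∣m-n∣ M i | ∣+m-+n∣≡∣m-n∣ m j = cong ℤ.+_ coprime
... | no ¬coprime with ∃-prime-divisor _ ¬coprime
...   | p , prime-p , p∣gcd =
  p , prime-p , ∣-trans p∣gcd (gcd[m,n]∣m ∣ M - i ∣ ∣ m - j ∣)
              , ∣-trans p∣gcd (gcd[m,n]∣n ∣ M - i ∣ ∣ m - j ∣)

blocked-sym : ∀ {M m r} → Blocked M m r → Blocked m M r
blocked-sym {r = r} blocked .shared-prime i j i+j<r
  with shared-prime blocked j i (subst (_< r) (+-comm i j) i+j<r)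
... | p , prime-p , p∣M-j , p∣m-i = p , prime-p , p∣m-i , p∣M-j

-- The cell (M - 1 , 0) is not blocked, since M - (M - 1) = 1.
blocked⇒≤ : ∀ {M m r} → 1 ≤ M → Blocked M m r → r ≤ M
blocked⇒≤ {suc M} {r = r} _ blocked with r ≤? suc M
... | yes r≤M = r≤M
... | no  r≰M with shared-prime blocked M 0 (subst (_< r) (sym (+-identityʳ M)) (<-trans (n<1+n M) (≰⇒> r≰M)))
...   | p , prime-p , p∣1 , _ =
  ⊥-elim (¬prime[1] (subst Prime (∣1⇒≡1 (subst (p ∣_) ∣1+M-M∣≡1 p∣1)) prime-p))
  where
  ∣1+M-M∣≡1 : ∣ suc M - M ∣ ≡ 1
  ∣1+M-M∣≡1 = trans (∣n-i∣≡n∸i (n≤1+n M)) (m+n∸n≡m 1 M)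

-- A prime serving two cells of a row divides the distance of their columns, so if the row
-- value is n-rough, the primes serving n consecutive columns are pairwise distinct.
row-primes : ∀ {M m r i n} → Blocked M m r → i + n ≤ r → n Rough ∣ M - i ∣ →
             ∃[ ps ] length ps ≡ n × Unique ps × All (λ p → Prime p × p ∣ ∣ M - i ∣) ps
row-primes {M} {m} {i = i} {n} blocked i+n≤r rough =
  tabulate prime-of , length-tabulate prime-of , Unique.tabulate⁺ injective ,
  All.tabulate⁺ (λ j → let (_ , prime-p , p∣row , _) = column j in prime-p , p∣row)
  where
  column : (j : Fin n) → ∃[ p ] Prime p × p ∣ ∣ M - i ∣ × p ∣ ∣ m - toℕ j ∣
  column j = shared-prime blocked i (toℕ j) (<-≤-trans (+-monoʳ-< i (toℕ<n j)) i+n≤r)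
  prime-of : Fin n → ℕ
  prime-of = proj₁ ∘ column
  injective : ∀ {j k} → prime-of j ≡ prime-of k → j ≡ k
  injective {j} {k} same with toℕ j ≟ toℕ k | column j | column k
  ... | yes j≡k | _ | _ = toℕ-injective j≡k
  ... | no  j≢k | p , prime-p , p∣row , p∣m-j | _ , _ , _ , q∣m-k = ⊥-elim (<⇒≱ distance<n n≤distance)
    where
    distance<n : ∣ toℕ j - toℕ k ∣ < n
    distance<n = ≤-<-trans (∣m-n∣≤m⊔n (toℕ j) (toℕ k)) (⊔-lub (toℕ<n j) (toℕ<n k))
    n≤distance : n ≤ ∣ toℕ j - toℕ k ∣
    n≤distance = ≤-trans (rough∧prime∣⇒≤ rough prime-p p∣row)
      (∣∣n-x∣∧∣∣n-y∣⇒≤∣x-y∣ {n = m} j≢k p∣m-j (subst (_∣ ∣ m - toℕ k ∣) (sym same) q∣m-k))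

row-product≤ : ∀ {M i ps} → i < M → Unique ps → All (λ p → Prime p × p ∣ ∣ M - i ∣) ps → product ps ≤ M
row-product≤ i<M uniq divisors =
  ≤-trans (∣⇒≤ {{∣n-i∣-nonZero i<M}} (product-∣ uniq divisors)) (∣n-i∣≤n (<⇒≤ i<M))

-- Small ρ: one row

∣n∧∣k+n⇒∣k : ∀ {d n} k → d ∣ n → d ∣ k + n → d ∣ k
∣n∧∣k+n⇒∣k {d} {n} k d∣n d∣k+n = ∣m+n∣m⇒∣n (subst (d ∣_) (+-comm k n) d∣k+n) d∣n

2∣n⊎2∣1+n : ∀ n → 2 ∣ n ⊎ 2 ∣ suc n
2∣n⊎2∣1+n zero    = inj₁ (2 ∣0)
2∣n⊎2∣1+n (suc n) with 2∣n⊎2∣1+n n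
... | inj₁ 2∣n   = inj₂ (∣m∣n⇒∣m+n (∣-refl {2}) 2∣n)
... | inj₂ 2∣1+n = inj₁ 2∣1+n

2∣n⇒2∤1+n : ∀ {n} → 2 ∣ n → ¬ 2 ∣ suc n
2∣n⇒2∤1+n 2∣n 2∣1+n = >⇒∤ ≤-refl (∣n∧∣k+n⇒∣k 1 2∣n 2∣1+n)

odd-gap : ∀ {x y} → x < y → ¬ 2 ∣ x → ¬ 2 ∣ y → 2 + x ≤ y
odd-gap {x} x<y 2∤x 2∤y with m≤n⇒m<n∨m≡n x<y
... | inj₁ 1+x<y = 1+x<y
... | inj₂ refl with 2∣n⊎2∣1+n x
...   | inj₁ 2∣x   = contradiction 2∣x 2∤x
...   | inj₂ 2∣1+x = contradiction 2∣1+x 2∤y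

Odd≥3 : ℕ → Set
Odd≥3 x = 3 ≤ x × ¬ 2 ∣ x

105≤product-of-distinct-odd : ∀ {x y z} → Unique (x ∷ y ∷ z ∷ []) → All Odd≥3 (x ∷ y ∷ z ∷ []) →
                              105 ≤ product (x ∷ y ∷ z ∷ [])
105≤product-of-distinct-odd {x} {y} {z} ((x≢y ∷ x≢z ∷ []) ∷ (y≢z ∷ []) ∷ [] ∷ []) (ox ∷ oy ∷ oz ∷ []) =
  by-order (<-cmp x y) (<-cmp y z) (<-cmp x z)
  where
  ordered : ∀ {a b c} → a < b → b < c → Odd≥3 a → Odd≥3 b → Odd≥3 c → 3 ≤ a × 5 ≤ b × 7 ≤ c
  ordered a<b b<c (3≤a , 2∤a) (_ , 2∤b) (_ , 2∤c) =
    3≤a , 5≤b , ≤-trans (+-monoʳ-≤ 2 5≤b) (odd-gap b<c 2∤b 2∤c)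
    where
    5≤b = ≤-trans (+-monoʳ-≤ 2 3≤a) (odd-gap a<b 2∤a 2∤b)

  within : ∀ {a b c} → a ≤ x → b ≤ y → c ≤ z → a * (b * (c * 1)) ≤ product (x ∷ y ∷ z ∷ [])
  within a≤x b≤y c≤z = *-mono-≤ a≤x (*-mono-≤ b≤y (*-mono-≤ c≤z ≤-refl))

  by-order : Tri (x < y) (x ≡ y) (x > y) → Tri (y < z) (y ≡ z) (y > z) → Tri (x < z) (x ≡ z) (x > z) →
             105 ≤ product (x ∷ y ∷ z ∷ [])
  by-order (tri≈ _ x≡y _) _              _              = contradiction x≡y x≢y
  by-order _              (tri≈ _ y≡z _) _              = contradiction y≡z y≢z
  by-order _              _              (tri≈ _ x≡z _) = contradiction x≡z x≢z
  by-order (tri< x<y _ _) (tri< y<z _ _) _              = let a , b , c = ordered x<y y<z ox oy oz in within a b c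
  by-order (tri< _ _ _)   (tri> _ _ z<y) (tri< x<z _ _) = let a , c , b = ordered x<z z<y ox oz oy in within a b c
  by-order (tri< x<y _ _) (tri> _ _ _)   (tri> _ _ z<x) = let c , a , b = ordered z<x x<y oz ox oy in within a b c
  by-order (tri> _ _ y<x) (tri< _ _ _)   (tri< x<z _ _) = let b , a , c = ordered y<x x<z oy ox oz in within a b c
  by-order (tri> _ _ _)   (tri< y<z _ _) (tri> _ _ z<x) = let b , c , a = ordered y<z z<x oy oz ox in within a b c
  by-order (tri> _ _ y<x) (tri> _ _ z<y) _              = let c , b , a = ordered z<y y<x oz oy ox in within a b c

2∤∧3∤⇒5-rough : ∀ {x} → ¬ 2 ∣ x → ¬ 3 ∣ x → 5 Rough x
2∤∧3∤⇒5-rough 2∤x 3∤x =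
  ∤⇒rough-suc (2∤x ∘ ∣-trans (divides 2 refl)) (∤⇒rough-suc 3∤x (∤⇒rough-suc 2∤x 2-rough))

-- Of two consecutive odd numbers at most one is a multiple of 3.
odd-pair-5-rough : ∀ {x} → ¬ 2 ∣ x → 5 Rough x ⊎ 5 Rough (2 + x)
odd-pair-5-rough {x} 2∤x with 3 ∣? x
... | no  3∤x = inj₁ (2∤∧3∤⇒5-rough 2∤x 3∤x)
... | yes 3∣x = inj₂ (2∤∧3∤⇒5-rough (λ 2∣2+x → 2∤x (∣m+n∣m⇒∣n 2∣2+x ∣-refl))
                                     (λ 3∣2+x → >⇒∤ ≤-refl (∣n∧∣k+n⇒∣k 2 3∣x 3∣2+x)))

odd-among-last-two : ∀ {n} → 1 ≤ n → ∃[ i ] i ≤ 1 × ¬ 2 ∣ n ∸ i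
odd-among-last-two {suc n} _ with 2∣n⊎2∣1+n n
... | inj₁ 2∣n   = 0 , z≤n , 2∣n⇒2∤1+n 2∣n
... | inj₂ 2∣1+n = 1 , ≤-refl , λ 2∣n → 2∣n⇒2∤1+n 2∣n 2∣1+n

5-rough-among-last-four : ∀ {n} → 3 ≤ n → ∃[ i ] i ≤ 3 × 5 Rough (n ∸ i)
5-rough-among-last-four {suc (suc (suc c))} (s≤s (s≤s (s≤s _))) with 2∣n⊎2∣1+n c
... | inj₁ 2∣c   = [ (λ r → 2 , s≤s (s≤s z≤n) , r) , (λ r → 0 , z≤n , r) ]′
                     (odd-pair-5-rough (2∣n⇒2∤1+n 2∣c))
... | inj₂ 2∣1+c = [ (λ r → 3 , ≤-refl , r) , (λ r → 1 , s≤s z≤n , r) ]′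
                     (odd-pair-5-rough (λ 2∣c → 2∣n⇒2∤1+n 2∣c 2∣1+c))

odd-row⇒105≤ : ∀ {M m r i} → i < M → i + 3 ≤ r → ¬ 2 ∣ ∣ M - i ∣ → Blocked M m r → 105 ≤ M
odd-row⇒105≤ {M} {i = i} i<M i+3≤r 2∤row blocked
  with row-primes {n = 3} blocked i+3≤r (∤⇒rough-suc 2∤row 2-rough)
... | x ∷ y ∷ z ∷ [] , refl , uniq , divisors =
  ≤-trans (105≤product-of-distinct-odd uniq (All.map odd divisors)) (row-product≤ i<M uniq divisors)
  where
  odd : ∀ {p} → Prime p × p ∣ ∣ M - i ∣ → Odd≥3 p
  odd (prime-p , p∣row) =
    rough∧prime∣⇒≤ (∤⇒rough-suc 2∤row 2-rough) prime-p p∣row , 2∤row ∘ flip ∣-trans p∣row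

5-rough-row⇒3125≤ : ∀ {M m r i} → i < M → i + 5 ≤ r → 5 Rough ∣ M - i ∣ → Blocked M m r → 3125 ≤ M
5-rough-row⇒3125≤ {M} {i = i} i<M i+5≤r rough blocked with row-primes {n = 5} blocked i+5≤r rough
... | ps , length≡5 , uniq , divisors = begin
  5 ^ 5          ≡⟨ cong (5 ^_) length≡5 ⟨
  5 ^ length ps  ≤⟨ ^-length≤product (All.map (λ (prime-p , p∣row) → 5≤ prime-p p∣row) divisors) ⟩
  product ps     ≤⟨ row-product≤ i<M uniq divisors ⟩
  M              ∎
  where
  open ≤-Reasoning
  5≤ : ∀ {p} → Prime p → p ∣ ∣ M - i ∣ → 5 ≤ p
  5≤ = rough∧prime∣⇒≤ rough

blocked⇒105≤ : ∀ {M m r} → 1 ≤ M → 4 ≤ r → Blocked M m r → 105 ≤ M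
blocked⇒105≤ {M} 1≤M 4≤r blocked = from-row (odd-among-last-two 1≤M)
  where
  from-row : ∃[ i ] i ≤ 1 × ¬ 2 ∣ M ∸ i → 105 ≤ M
  from-row (i , i≤1 , 2∤M-i) =
    odd-row⇒105≤ i<M (≤-trans (+-monoˡ-≤ 3 i≤1) 4≤r)
      (subst (λ a → ¬ 2 ∣ a) (sym (∣n-i∣≡n∸i (<⇒≤ i<M))) 2∤M-i) blocked
    where
    i<M : i < M
    i<M = ≤-trans (s≤s i≤1) (≤-trans (m≤m+n 2 2) (≤-trans 4≤r (blocked⇒≤ 1≤M blocked)))

blocked⇒3125≤ : ∀ {M m r} → 1 ≤ M → 8 ≤ r → Blocked M m r → 3125 ≤ M
blocked⇒3125≤ {M} 1≤M 8≤r blocked = from-row (5-rough-among-last-four (≤-trans (n≤1+n 3) 4≤M))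
  where
  4≤M : 4 ≤ M
  4≤M = ≤-trans (m≤m+n 4 4) (≤-trans 8≤r (blocked⇒≤ 1≤M blocked))
  from-row : ∃[ i ] i ≤ 3 × 5 Rough (M ∸ i) → 3125 ≤ M
  from-row (i , i≤3 , rough) =
    5-rough-row⇒3125≤ i<M (≤-trans (+-monoˡ-≤ 5 i≤3) 8≤r)
      (subst (5 Rough_) (sym (∣n-i∣≡n∸i (<⇒≤ i<M))) rough) blocked
    where
    i<M : i < M
    i<M = ≤-trans (s≤s i≤3) 4≤M

-- Large ρ: counting the cells of a dyadic square

module SquareCount (M m t : ℕ)
  (cover : ∀ {i j} → i < 2 ^ (2 + t) → j < 2 ^ (2 + t) →
           ∃[ p ] Prime p × p ∣ ∣ M - i ∣ × p ∣ ∣ m - j ∣)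
  (K≤M : 2 ^ (2 + t) ≤ M) (M<K⁴ : M < (2 ^ (2 + t)) ^ 4) where

  K : ℕ
  K = 2 ^ (2 + t)

  instance
    K-nonZero : NonZero K
    K-nonZero = m^n≢0 2 (2 + t)

  𝟙row 𝟙col : ℕ → ℕ → ℕ
  𝟙row i p = 𝟙 (prime? p ×-dec p ∣? ∣ M - i ∣)
  𝟙col j p = 𝟙 (p ∣? ∣ m - j ∣)

  -- The prime p serves at most cells p of the cells (i , j) with i , j < K.
  rows cols cells : ℕ → ℕ
  rows  p = ∑[ i < K ] 𝟙row i p
  cols  p = ∑[ j < K ] 𝟙col j p
  cells p = rows p * cols p

  row-nonZero : ∀ {i} → i < K → NonZero ∣ M - i ∣
  row-nonZero i<K = ∣n-i∣-nonZero (<-≤-trans i<K K≤M)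

  row≤M : ∀ {i} → i < K → ∣ M - i ∣ ≤ M
  row≤M i<K = ∣n-i∣≤n (<⇒≤ (<-≤-trans i<K K≤M))

  cell-served : ∀ {i j} → i < K → j < K → 1 ≤ ∑[ p < suc M ] (𝟙row i p * 𝟙col j p)
  cell-served {i} {j} i<K j<K with cover i<K j<K
  ... | p , prime-p , p∣row , p∣col = begin
    1                                  ≡⟨ cong₂ _*_ (𝟙-yes (prime? p ×-dec _) (prime-p , p∣row))
                                                    (𝟙-yes (p ∣? _) p∣col) ⟨
    𝟙row i p * 𝟙col j p                ≤⟨ term≤∑ (suc M) (λ q → 𝟙row i q * 𝟙col j q) (s≤s p≤M) ⟩
    ∑[ q < suc M ] (𝟙row i q * 𝟙col j q) ∎
    where
    open ≤-Reasoning
    p≤M : p ≤ M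
    p≤M = ≤-trans (∣⇒≤ {{row-nonZero i<K}} p∣row) (row≤M i<K)

  square≤∑cells : K * K ≤ ∑[ p < suc M ] cells p
  square≤∑cells = begin
    K * K                                          ≡⟨ cong (K *_) (*-identityʳ K) ⟨
    K * (K * 1)                                    ≡⟨ trans (∑-cong K (λ _ → ∑-const K 1)) (∑-const K (K * 1)) ⟨
    ∑[ i < K ] ∑[ j < K ] 1                        ≤⟨ ∑-mono-≤ K (λ i<K → ∑-mono-≤ K (cell-served i<K)) ⟩
    ∑[ i < K ] ∑[ j < K ] ∑[ p < suc M ] hit i j p ≡⟨ ∑-cong K (λ i → ∑-comm K (suc M) (hit i)) ⟩
    ∑[ i < K ] ∑[ p < suc M ] ∑[ j < K ] hit i j p ≡⟨ ∑-comm K (suc M) _ ⟩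
    ∑[ p < suc M ] ∑[ i < K ] ∑[ j < K ] hit i j p ≡⟨ ∑-cong (suc M) (λ p → ∑-*-∑ K K (flip 𝟙row p) (flip 𝟙col p)) ⟩
    ∑[ p < suc M ] cells p                         ∎
    where
    open ≤-Reasoning
    hit : ℕ → ℕ → ℕ → ℕ
    hit i j p = 𝟙row i p * 𝟙col j p

  rows≤ : ∀ {p L} d → L ≤ p → d * L ≡ K → rows p ≤ d
  rows≤ {p} {L} d L≤p dL≡K = subst (λ n → ∑[ i < n ] 𝟙row i p ≤ d) dL≡K
    (∑-𝟙-separated (λ i → prime? p ×-dec p ∣? ∣ M - i ∣) separated d)
    where
    separated : Separated L (λ i → Prime p × p ∣ ∣ M - i ∣)
    separated x≢y (_ , p∣x) (_ , p∣y) = ≤-trans L≤p (∣∣n-x∣∧∣∣n-y∣⇒≤∣x-y∣ {n = M} x≢y p∣x p∣y)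

  cols≤ : ∀ {p L} d → L ≤ p → d * L ≡ K → cols p ≤ d
  cols≤ {p} {L} d L≤p dL≡K = subst (λ n → ∑[ j < n ] 𝟙col j p ≤ d) dL≡K
    (∑-𝟙-separated (λ j → p ∣? ∣ m - j ∣) separated d)
    where
    separated : Separated L (λ j → p ∣ ∣ m - j ∣)
    separated x≢y p∣x p∣y = ≤-trans L≤p (∣∣n-x∣∧∣∣n-y∣⇒≤∣x-y∣ {n = m} x≢y p∣x p∣y)

  rows-nonprime : ∀ {p} → ¬ Prime p → rows p ≡ 0
  rows-nonprime {p} ¬prime = ∑-𝟙≡0 (λ i → prime? p ×-dec p ∣? ∣ M - i ∣) K (λ _ → ¬prime ∘ proj₁)

  cells≤ : ∀ {p L} d → L ≤ p → d * L ≡ K → cells p ≤ 𝟙 (prime? p) * (d * d)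
  cells≤ {p} d L≤p dL≡K = ≤-𝟙* (prime? p)
    (λ _ → *-mono-≤ (rows≤ d L≤p dL≡K) (cols≤ d L≤p dL≡K))
    (λ ¬prime → cong (_* cols p) (rows-nonprime ¬prime))

  -- |M - i| ≤ M < K⁴ has at most three prime factors ≥ K.
  large-prime-factors≤3 : ∀ {i} → i < K → ∑[ x < suc M ∸ K ] 𝟙row i (K + x) ≤ 3
  large-prime-factors≤3 {i} i<K with 4 ≤? ∑[ x < suc M ∸ K ] 𝟙row i (K + x)
  ... | no  4≰count = ≤-pred (≰⇒> 4≰count)
  ... | yes 4≤count = contradiction M<K⁴ (≤⇒≯ (begin
    K ^ 4                                   ≤⟨ ^-monoʳ-≤ K 4≤count ⟩
    K ^ (∑[ x < suc M ∸ K ] 𝟙row i (K + x)) ≤⟨ ^-∑-prime-divisors≤ {{row-nonZero i<K}} K (suc M ∸ K) ⟩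
    ∣ M - i ∣                               ≤⟨ row≤M i<K ⟩
    M                                       ∎))
    where open ≤-Reasoning

  ∑-large-cells≤ : ∑[ x < suc M ∸ K ] cells (K + x) ≤ 3 * K
  ∑-large-cells≤ = begin
    ∑[ x < N ] cells (K + x)             ≤⟨ ∑-mono-≤ N (λ {x} _ → cells≤rows (m≤m+n K x)) ⟩
    ∑[ x < N ] ∑[ i < K ] 𝟙row i (K + x) ≡⟨ ∑-comm N K _ ⟩
    ∑[ i < K ] ∑[ x < N ] 𝟙row i (K + x) ≤⟨ ∑-mono-≤ K large-prime-factors≤3 ⟩
    ∑[ i < K ] 3                         ≡⟨ trans (∑-const K 3) (*-comm K 3) ⟩
    3 * K                                ∎
    where
    open ≤-Reasoning
    N = suc M ∸ K
    cells≤rows : ∀ {p} → K ≤ p → cells p ≤ rows p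
    cells≤rows {p} K≤p = ≤-trans (*-monoʳ-≤ (rows p) (cols≤ 1 K≤p (*-identityˡ K)))
                                 (≤-reflexive (*-identityʳ (rows p)))

  ∑-level≤ : ∀ s d → d * 2 ^ (2 + s) ≡ K →
             ∑[ w < 2 ^ (2 + s) ] cells (2 ^ (2 + s) + w) ≤ 2 ^ (1 + s) * (d * d)
  ∑-level≤ s d dL≡K = begin
    ∑[ w < L ] cells (L + w)                   ≤⟨ ∑-mono-≤ L (λ {w} _ → cells≤ d (m≤m+n L w) dL≡K) ⟩
    ∑[ w < L ] (𝟙 (prime? (L + w)) * (d * d))  ≡⟨ *-distribʳ-∑ L (d * d) _ ⟨
    ∑[ w < L ] 𝟙 (prime? (L + w)) * (d * d)    ≤⟨ *-monoˡ-≤ (d * d) primes≤ ⟩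
    2 ^ (1 + s) * (d * d)                      ∎
    where
    open ≤-Reasoning
    L = 2 ^ (2 + s)
    2<L : 2 < L
    2<L = ≤-trans (n≤1+n 3) (^-monoʳ-≤ 2 (m≤m+n 2 s))
    primes≤ : ∑[ w < L ] 𝟙 (prime? (L + w)) ≤ 2 ^ (1 + s)
    primes≤ = subst (λ n → ∑[ w < n ] 𝟙 (prime? (L + w)) ≤ 2 ^ (1 + s)) (*-comm (2 ^ (1 + s)) 2)
      (∑-𝟙-prime-window≤ 2<L (m∣m*n (2 ^ (1 + s))) (2 ^ (1 + s)))

  -- The primes below L serve at most 3K²/4 − K·(K/L) cells.
  Dyadic : ℕ → Set
  Dyadic L = ∀ {d} → d * L ≡ K → 4 * (∑[ p < L ] cells p + K * d) ≤ 3 * (K * K)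

  dyadic : ∀ s → Dyadic (2 ^ (2 + s))
  dyadic zero {d} d4≡K = begin
    4 * (∑[ p < 4 ] cells p + K * d)  ≡⟨ cong (λ c → 4 * (c + K * d)) ∑[p<4]cells≡ ⟩
    4 * (cells 2 + cells 3 + K * d)   ≤⟨ *-monoʳ-≤ 4 (+-monoˡ-≤ (K * d) (+-mono-≤ (cells≤X ≤-refl) (cells≤X (n≤1+n 2)))) ⟩
    4 * (X + X + K * d)               ≡⟨ subst (λ k → 4 * (X + X + k * d) ≡ 3 * (k * k)) d4≡K (identity d) ⟩
    3 * (K * K)                       ∎
    where
    open ≤-Reasoning
    X = (d * 2) * (d * 2)
    ∑[p<4]cells≡ : ∑[ p < 4 ] cells p ≡ cells 2 + cells 3
    ∑[p<4]cells≡ = cong₂ (λ a b → 0 + a * cols 0 + b * cols 1 + cells 2 + cells 3)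
                         (rows-nonprime ¬prime[0]) (rows-nonprime ¬prime[1])
    cells≤X : ∀ {p} → 2 ≤ p → cells p ≤ X
    cells≤X {p} 2≤p = ≤-trans (cells≤ (d * 2) 2≤p (trans (*-assoc d 2 2) d4≡K)) (𝟙*≤ (prime? p) X)
    identity : ∀ d → 4 * ((d * 2) * (d * 2) + (d * 2) * (d * 2) + (d * 4) * d) ≡ 3 * ((d * 4) * (d * 4))
    identity = solve-∀
  dyadic (suc s) {d} dL≡K = begin
    4 * (∑[ p < 2 * L ] cells p + K * d)   ≡⟨ cong (λ c → 4 * (c + K * d)) split ⟩
    4 * (S + level + K * d)                ≡⟨ cong (4 *_) (+-assoc S level (K * d)) ⟩
    4 * (S + (level + K * d))              ≤⟨ *-monoʳ-≤ 4 (+-monoʳ-≤ S level+Kd≤) ⟩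
    4 * (S + K * (d * 2))                  ≤⟨ dyadic s {d * 2} d2L≡K ⟩
    3 * (K * K)                            ∎
    where
    open ≤-Reasoning
    L = 2 ^ (2 + s)
    S = ∑[ p < L ] cells p
    level = ∑[ w < L ] cells (L + w)
    d2L≡K : d * 2 * L ≡ K
    d2L≡K = trans (*-assoc d 2 L) dL≡K
    split : ∑[ p < 2 * L ] cells p ≡ S + level
    split = trans (cong (λ n → ∑ n cells) (cong (L +_) (+-identityʳ L))) (∑-+ L L cells)
    identity : ∀ X d → X * ((d * 2) * (d * 2)) + (d * (2 * (2 * X))) * d ≡ (d * (2 * (2 * X))) * (d * 2)
    identity = solve-∀
    level+Kd≤ : level + K * d ≤ K * (d * 2)
    level+Kd≤ = subst (λ k → level + k * d ≤ k * (d * 2)) dL≡K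
      (≤-trans (+-monoˡ-≤ _ (∑-level≤ s (d * 2) d2L≡K)) (≤-reflexive (identity (2 ^ (1 + s)) d)))

  K≤8 : K ≤ 8
  K≤8 = *-cancelˡ-≤ K (+-cancelˡ-≤ (3 * (K * K)) (K * K) (K * 8) (begin
    3 * (K * K) + K * K        ≡⟨ four-squares K ⟩
    4 * (K * K)                ≤⟨ *-monoʳ-≤ 4 square≤ ⟩
    4 * (S + 3 * K)            ≡⟨ regroup S K ⟩
    4 * (S + K * 1) + K * 8    ≤⟨ +-monoˡ-≤ (K * 8) (dyadic t (*-identityˡ K)) ⟩
    3 * (K * K) + K * 8        ∎))
    where
    open ≤-Reasoning
    S = ∑[ p < K ] cells p
    square≤ : K * K ≤ S + 3 * K
    square≤ = begin
      K * K                                ≤⟨ square≤∑cells ⟩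
      ∑[ p < suc M ] cells p               ≡⟨ cong (λ n → ∑ n cells) (m+[n∸m]≡n (m≤n⇒m≤1+n K≤M)) ⟨
      ∑[ p < K + (suc M ∸ K) ] cells p     ≡⟨ ∑-+ K (suc M ∸ K) cells ⟩
      S + ∑[ x < suc M ∸ K ] cells (K + x) ≤⟨ +-monoʳ-≤ S ∑-large-cells≤ ⟩
      S + 3 * K                            ∎
    four-squares : ∀ K → 3 * (K * K) + K * K ≡ 4 * (K * K)
    four-squares = solve-∀
    regroup : ∀ S K → 4 * (S + 3 * K) ≡ 4 * (S + K * 1) + K * 8
    regroup = solve-∀

power-of-two-bracket : ∀ k → ∃[ t ] 2 * 2 ^ (2 + t) ≤ 8 + k × 8 + k < 4 * 2 ^ (2 + t)
power-of-two-bracket zero    = 0 , ≤-refl , m≤m+n 9 7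
power-of-two-bracket (suc k) with power-of-two-bracket k
... | t , lo , hi with 9 + k <? 4 * 2 ^ (2 + t)
...   | yes hi′ = t , ≤-trans lo (n≤1+n _) , hi′
...   | no  hi′ = suc t , ≤-reflexive (trans (sym (*-assoc 2 2 (2 ^ (2 + t)))) (sym 9+k≡4K)) ,
                  subst (_< 4 * 2 ^ (3 + t)) (sym 9+k≡4K) (*-monoʳ-< 4 (^-monoʳ-< 2 ≤-refl (n<1+n (2 + t))))
  where
  9+k≡4K : 9 + k ≡ 4 * 2 ^ (2 + t)
  9+k≡4K = ≤-antisym hi (≮⇒≥ hi′)

square-blocked : ∀ {M m r K} → Blocked M m r → 2 * K ≤ suc r →
                 ∀ {i j} → i < K → j < K → ∃[ p ] Prime p × p ∣ ∣ M - i ∣ × p ∣ ∣ m - j ∣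
square-blocked {r = r} {K} blocked 2K≤1+r {i} {j} i<K j<K = shared-prime blocked i j (≤-pred (begin
  suc (suc (i + j))  ≡⟨ cong suc (+-suc i j) ⟨
  suc i + suc j      ≤⟨ +-mono-≤ i<K j<K ⟩
  K + K              ≡⟨ cong (K +_) (+-identityʳ K) ⟨
  2 * K              ≤⟨ 2K≤1+r ⟩
  suc r              ∎))
  where open ≤-Reasoning

[r+3]²≤K⁴ : ∀ {r K} → 5 ≤ K → suc r < 4 * K → (r + 3) * (r + 3) ≤ K ^ 4
[r+3]²≤K⁴ {r} {K} 5≤K 1+r<4K = begin
  (r + 3) * (r + 3)  ≤⟨ *-mono-≤ r+3≤5K r+3≤5K ⟩
  (5 * K) * (5 * K)  ≡⟨ square-of-5* K ⟩
  25 * (K * K)       ≤⟨ *-monoˡ-≤ (K * K) (*-mono-≤ 5≤K 5≤K) ⟩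
  (K * K) * (K * K)  ≡⟨ square-of-square K ⟩
  K ^ 4              ∎
  where
  open ≤-Reasoning
  r+3≤5K : r + 3 ≤ 5 * K
  r+3≤5K = begin
    r + 3      ≡⟨ +-comm r 3 ⟩
    3 + r      ≤⟨ s≤s 1+r<4K ⟩
    1 + 4 * K  ≤⟨ +-monoˡ-≤ (4 * K) (≤-trans (s≤s z≤n) 5≤K) ⟩
    5 * K      ∎
  square-of-5* : ∀ K → (5 * K) * (5 * K) ≡ 25 * (K * K)
  square-of-5* = solve-∀
  square-of-square : ∀ K → (K * K) * (K * K) ≡ K * (K * (K * (K * 1)))
  square-of-square = solve-∀

blocked⇒bound-31≤r : ∀ {M m r} → 1 ≤ M → 31 ≤ r → Blocked M m r → (r + 3) * (r + 3) ≤ M + 5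
blocked⇒bound-31≤r {M} {m} {r} 1≤M 31≤r blocked
  with (r + 3) * (r + 3) ≤? M + 5 | power-of-two-bracket (r ∸ 7)
... | yes bound  | _                   = bound
... | no  ¬bound | t , 2K≤8+k , 8+k<4K =
  contradiction (SquareCount.K≤8 M m t (square-blocked blocked 2K≤1+r) K≤M M<K⁴) (<⇒≱ 8<K)
  where
  K = 2 ^ (2 + t)
  8+k≡1+r : 8 + (r ∸ 7) ≡ suc r
  8+k≡1+r = cong suc (m+[n∸m]≡n (≤-trans (m≤m+n 7 24) 31≤r))
  2K≤1+r : 2 * K ≤ suc r
  2K≤1+r = subst (2 * K ≤_) 8+k≡1+r 2K≤8+k
  1+r<4K : suc r < 4 * K
  1+r<4K = subst (_< 4 * K) 8+k≡1+r 8+k<4K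
  8<K : 8 < K
  8<K = *-cancelˡ-< 4 8 K (≤-<-trans (s≤s 31≤r) 1+r<4K)
  K<2K : K < 2 * K
  K<2K = subst (K <_) (cong (K +_) (sym (+-identityʳ K))) (m<m+n K (m^n>0 2 (2 + t)))
  K≤M : K ≤ M
  K≤M = ≤-trans (≤-pred (<-≤-trans K<2K 2K≤1+r)) (blocked⇒≤ 1≤M blocked)
  M<K⁴ : M < K ^ 4
  M<K⁴ = <-≤-trans (<-trans (m<m+n M (s≤s z≤n)) (≰⇒> ¬bound))
                   ([r+3]²≤K⁴ (≤-trans (m≤m+n 5 4) 8<K) 1+r<4K)

blocked⇒bound : ∀ {M m r} → 1 ≤ M → 4 ≤ r → Blocked M m r → (r + 3) * (r + 3) ≤ M + 5
blocked⇒bound {M} {r = r} 1≤M 4≤r blocked with r <? 8 | r <? 31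
... | yes r<8 | _        = begin
  (r + 3) * (r + 3)  ≤⟨ *-mono-≤ r+3≤10 r+3≤10 ⟩
  10 * 10            ≤⟨ m≤m+n 100 10 ⟩
  105 + 5            ≤⟨ +-monoˡ-≤ 5 (blocked⇒105≤ 1≤M 4≤r blocked) ⟩
  M + 5              ∎
  where
  open ≤-Reasoning
  r+3≤10 = +-monoˡ-≤ 3 (≤-pred r<8)
... | no r≮8  | yes r<31 = begin
  (r + 3) * (r + 3)  ≤⟨ *-mono-≤ r+3≤33 r+3≤33 ⟩
  33 * 33            ≤⟨ m≤m+n 1089 2041 ⟩
  3125 + 5           ≤⟨ +-monoˡ-≤ 5 (blocked⇒3125≤ 1≤M (≮⇒≥ r≮8) blocked) ⟩
  M + 5              ∎
  where
  open ≤-Reasoning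
  r+3≤33 = +-monoˡ-≤ 3 (≤-pred r<31)
... | no _    | no r≮31  = blocked⇒bound-31≤r 1≤M (≮⇒≥ r≮31) blocked

proposition5p1 : ∀ (m M r : ℕ) → 1 ≤ m → 1 ≤ M → IsRho m M r → 4 ≤ r →
    (r + 3) * (r + 3) ≤ (m ⊓ M) + 5
proposition5p1 m M r 1≤m 1≤M ρ 4≤r =
  subst ((r + 3) * (r + 3) ≤_) (sym (+-distribʳ-⊓ 5 m M))
    (⊓-glb (blocked⇒bound 1≤m 4≤r (blocked-sym blocked)) (blocked⇒bound 1≤M 4≤r blocked))
  where
  blocked = isRho⇒blocked ρ
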